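{- Let $G=\{X,B\}$ be a connected, locally finite graph with an infinite node set $X$, and let $^{*}G$ be its enlargement with respect to a fixed free ultrafilter $\mathcal F$ on $\mathbb N$. Then $^{*}G$ has at least one hypernode not in its principal galaxy $\Gamma_0$, and thus at least one galaxy $\Gamma_1$ different from $\Gamma_0$.
   Context: $G=\{X,B\}$ is a graph whose branches are two-element subsets of $X$. $d(x,y)$ is the length (number of branches) of a shortest path between nodes $x,y$. A hypernode is a class $\mathbf x=[x_n]$ of sequences of nodes of $G$ modulo the relation $\langle x_n\rangle\sim\langle y_n\rangle$ iff $\{n:x_n=y_n\}\in\mathcal F$; ${}^{*}X$ is the set of hypernodes; a hypernode is standard if it has a constant representative. A hyperbranch is a class $[\{x_n,y_n\}]$ with $\{n:\{x_n,y_n\}\in B\}\in\mathcal F$. The enlargement is ${}^{*}G=\{{}^{*}X,{}^{*}B\}$. Hypernodes $[x_n],[y_n]$ are limitedly distant if there is $k\in\mathbb N$ with $\{n:d(x_n,y_n)\le k\}\in\mathcal F$; this is an equivalence relation whose classes are the nodal galaxies. A galaxy is the subgraph of ${}^{*}G$ consisting of the hypernodes of one nodal galaxy together with all hyperbranches both of whose hypernodes lie in it. The principal galaxy $\Gamma_0$ is the galaxy containing the standard hypernodes. -}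

module Defs where

open import Data.Nat using (ℕ; zero; suc; _≤_)
open import Data.Product using (Σ; ∃; _×_; _,_)
open import Data.Sum using (_⊎_)
open import Data.Empty using (⊥)
open import Data.List using (List)
open import Data.List.Membership.Propositional using (_∈_; _∉_)
open import Relation.Nullary using (¬_)
open import Relation.Binary.PropositionalEquality using (_≡_; _≢_)

-- Graphs G = {X, B}: branches are two-element subsets of X, encoded as a
-- symmetric, irreflexive adjacency relation.

record Graph : Set₁ where
  field
    Node    : Set
    Adj     : Node → Node → Set
    Adj-sym : ∀ {x y} → Adj x y → Adj y x
    Adj-irr : ∀ {x y} → Adj x y → x ≢ y

module _ (G : Graph) where
  open Graph G

  data Walk : Node → Node → ℕ → Set where
    here : ∀ {x} → Walk x x zero
    step : ∀ {x y z k} → Adj x y → Walk y z k → Walk x z (suc k)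

  Dist≤ : Node → Node → ℕ → Set
  Dist≤ x y k = ∃ λ j → j ≤ k × Walk x y j

  Connected : Set
  Connected = ∀ x y → ∃ λ k → Walk x y k

  LocallyFinite : Set
  LocallyFinite = ∀ x → Σ (List Node) λ ns → ∀ y → (Adj x y → y ∈ ns) × (y ∈ ns → Adj x y)

  InfiniteNodes : Set
  InfiniteNodes = ∀ (l : List Node) → ∃ λ x → x ∉ l

SubsetOfℕ : Set₁
SubsetOfℕ = ℕ → Set

record FreeUltrafilter (F : SubsetOfℕ → Set) : Set₁ where
  field
    full      : F (λ _ → ℕ)
    proper    : ¬ F (λ _ → ⊥)
    upward    : ∀ {A B : SubsetOfℕ} → (∀ n → A n → B n) → F A → F B
    intersect : ∀ {A B : SubsetOfℕ} → F A → F B → F (λ n → A n × B n)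
    ultra     : ∀ (A : SubsetOfℕ) → F A ⊎ F (λ n → ¬ A n)
    free      : ∀ (l : List ℕ) → ¬ F (λ n → n ∈ l)

-- Enlargement: hypernodes are sequences of nodes modulo agreement on a
-- set of F; we work with representatives.

module Enlargement (G : Graph) (F : SubsetOfℕ → Set) where
  open Graph G

  HyperSeq : Set
  HyperSeq = ℕ → Node

  _∼_ : HyperSeq → HyperSeq → Set
  x ∼ y = F (λ n → x n ≡ y n)

  Standard : HyperSeq → Set
  Standard x = ∃ λ (a : Node) → x ∼ (λ _ → a)

  LimitedlyDistant : HyperSeq → HyperSeq → Set
  LimitedlyDistant x y = ∃ λ (k : ℕ) → F (λ n → Dist≤ G (x n) (y n) k)

  InPrincipalGalaxy : HyperSeq → Set
  InPrincipalGalaxy x = ∃ λ (s : HyperSeq) → Standard s × LimitedlyDistant x s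

module Submission where

open import Defs
open import Data.Product using (Σ; ∃; _,_; proj₁; proj₂)
open import Data.Nat using (ℕ; zero; suc; _+_; _≤_; _<_; _≤′_; ≤′-refl; ≤′-step; _≤?_)
open import Data.Nat.Properties using (≤⇒≤′; ≰⇒>; ≤-trans; +-monoˡ-≤)
open import Data.List using (List; []; _∷_; _++_; concatMap; upTo)
open import Data.List.Relation.Unary.Any as Any using ()
open import Data.List.Membership.Propositional using (_∈_; _∉_; lose)
open import Data.List.Membership.Propositional.Properties using (∈-++⁺ˡ; ∈-++⁺ʳ; ∈-concatMap⁺; ∈-upTo⁺)
open import Relation.Nullary using (¬_; yes; no; contradiction)
open import Relation.Binary.PropositionalEquality using (refl; subst)

-- Fix a node a₀. Local finiteness makes every ball around a₀ a finite list, and since the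
-- node set is infinite we may pick xₙ outside the ball of radius n. A node a lies at some
-- finite distance c from a₀, so d(xₙ, a) ≤ k forces n < k + c: the indices where ⟨xₙ⟩ is
-- within k of a standard hypernode form a finite set, which a free ultrafilter omits.

module _ {F : SubsetOfℕ → Set} (U : FreeUltrafilter F) where
  open FreeUltrafilter U

  bounded∉ultrafilter : ∀ {A : SubsetOfℕ} N → (∀ {n} → A n → n < N) → ¬ F A
  bounded∉ultrafilter N bound FA = free (upTo N) (upward (λ _ An → ∈-upTo⁺ (bound An)) FA)

module _ {G : Graph} where
  open Graph G

  walk-++ : ∀ {x y z j k} → Walk G x y j → Walk G y z k → Walk G x z (j + k)
  walk-++ here       w = w
  walk-++ (step a v) w = step a (walk-++ v w)

  module Balls (lf : LocallyFinite G) where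

    neighbours : Node → List Node
    neighbours x = proj₁ (lf x)

    adj⇒∈neighbours : ∀ {x y} → Adj x y → y ∈ neighbours x
    adj⇒∈neighbours {x} {y} = proj₁ (proj₂ (lf x) y)

    ball : Node → ℕ → List Node
    ball a zero    = a ∷ []
    ball a (suc m) = ball a m ++ concatMap neighbours (ball a m)

    ball-step : ∀ {a m y z} → y ∈ ball a m → Adj y z → z ∈ ball a (suc m)
    ball-step {a} {m} y∈ adj = ∈-++⁺ʳ (ball a m) (∈-concatMap⁺ neighbours (lose y∈ (adj⇒∈neighbours adj)))

    ball-mono : ∀ {a m n y} → m ≤ n → y ∈ ball a m → y ∈ ball a n
    ball-mono m≤n = mono′ (≤⇒≤′ m≤n)
      where
      mono′ : ∀ {a m n y} → m ≤′ n → y ∈ ball a m → y ∈ ball a n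
      mono′ ≤′-refl      y∈ = y∈
      mono′ (≤′-step le) y∈ = ∈-++⁺ˡ (mono′ le y∈)

    walk⇒∈ball : ∀ {x a j} → Walk G x a j → x ∈ ball a j
    walk⇒∈ball here                 = Any.here refl
    walk⇒∈ball (step {k = j} adj w) = ball-step {m = j} (walk⇒∈ball w) (Adj-sym adj)

  module Escape (conn : Connected G) (lf : LocallyFinite G) (inf : InfiniteNodes G) (a₀ : Node) where
    open Balls lf

    escape : ℕ → Node
    escape n = proj₁ (inf (ball a₀ n))

    escape-∉ball : ∀ n → escape n ∉ ball a₀ n
    escape-∉ball n = proj₂ (inf (ball a₀ n))

    escape-near⇒bounded : ∀ a k → ∃ λ N → ∀ {n} → Dist≤ G (escape n) a k → n < N
    escape-near⇒bounded a k = k + c , near⇒bounded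
      where
      c : ℕ
      c = proj₁ (conn a a₀)

      near⇒bounded : ∀ {n} → Dist≤ G (escape n) a k → n < k + c
      near⇒bounded {n} (j , j≤k , w) with k + c ≤? n
      ... | no k+c≰n = ≰⇒> k+c≰n
      ... | yes k+c≤n = contradiction (ball-mono (≤-trans (+-monoˡ-≤ c j≤k) k+c≤n) escape∈) (escape-∉ball n)
        where
        escape∈ : escape n ∈ ball a₀ (j + c)
        escape∈ = walk⇒∈ball (walk-++ w (proj₂ (conn a a₀)))

theorem3p7 : (G : Graph) → Connected G → LocallyFinite G → InfiniteNodes G → (F : SubsetOfℕ → Set) → FreeUltrafilter F → Σ (Enlargement.HyperSeq G F) λ x → ¬ Enlargement.InPrincipalGalaxy G F x
theorem3p7 G conn lf inf F U = escape , notPrincipal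
  where
  open Escape conn lf inf (proj₁ (inf []))
  open FreeUltrafilter U using (intersect)

  notPrincipal : ¬ Enlargement.InPrincipalGalaxy G F escape
  notPrincipal (s , (a , s∼a) , (k , near)) with escape-near⇒bounded a k
  ... | N , bound =
    bounded∉ultrafilter U N (λ { (d , sₙ≡a) → bound (subst (λ b → Dist≤ G _ b k) sₙ≡a d) }) (intersect near s∼a)
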